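{- Let $w \in S_n$ be a permutation. If $|B(w)| = 1$ or $|C(w)| = 1$, then $$|B(w)| + |C(w)| - 1 = |R(w)| = |B(w)|\cdot|C(w)|.$$
   Context: $S_n$ is generated by the adjacent transpositions $s_1,\dots,s_{n-1}$. A reduced word for $w$ is a sequence $i_1\cdots i_k$ with $w = s_{i_1}\cdots s_{i_k}$ and $k=\ell(w)$ minimal; $R(w)$ is the set of reduced words of $w$. A braid move replaces a factor (consecutive letters) $i(i+1)i$ by $(i+1)i(i+1)$ or vice versa; a commutation move replaces a factor $ij$ with $|i-j|>1$ by $ji$. $B(w)$ is the set of equivalence classes of $R(w)$ under sequences of braid moves, and $C(w)$ is the set of equivalence classes of $R(w)$ under sequences of commutation moves. -}

module Defs where

open import Data.Nat using (ℕ; zero; suc; _<_; _≤_; _∸_; _≟_)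
open import Data.Fin using (Fin; toℕ)
open import Data.Fin.Permutation using (Permutation′; _⟨$⟩ʳ_)
open import Data.List using (List; []; _∷_; _++_; length)
open import Data.List.Relation.Unary.All using (All)
open import Data.List.Relation.Unary.Any using (Any)
open import Data.List.Relation.Unary.AllPairs using (AllPairs)
open import Data.Product using (_×_; Σ-syntax)
open import Data.Sum using (_⊎_)
open import Relation.Nullary using (¬_; yes; no)
open import Relation.Binary.PropositionalEquality using (_≡_)
open import Relation.Binary.Construct.Closure.ReflexiveTransitive using (Star)

-- Letters are natural numbers i with 1 ≤ i < n; s_i swaps the (0-indexed)
-- points i ∸ 1 and i of {0,…,n-1}.
ValidLetter : ℕ → ℕ → Set
ValidLetter n i = 1 ≤ i × i < n

sAct : ℕ → ℕ → ℕ
sAct i j with j ≟ i ∸ 1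
... | yes _ = i
... | no _ with j ≟ i
...   | yes _ = i ∸ 1
...   | no _ = j

evalWord : List ℕ → ℕ → ℕ
evalWord [] j = j
evalWord (i ∷ is) j = sAct i (evalWord is j)

IsWord : (n : ℕ) → Permutation′ n → List ℕ → Set
IsWord n w ws = All (ValidLetter n) ws × (∀ (j : Fin n) → toℕ (w ⟨$⟩ʳ j) ≡ evalWord ws (toℕ j))

IsReduced : (n : ℕ) → Permutation′ n → List ℕ → Set
IsReduced n w ws = IsWord n w ws × (∀ vs → IsWord n w vs → length ws ≤ length vs)

data BraidStep : List ℕ → List ℕ → Set where
  braid⁺ : ∀ u i v → BraidStep (u ++ i ∷ suc i ∷ i ∷ v) (u ++ suc i ∷ i ∷ suc i ∷ v)
  braid⁻ : ∀ u i v → BraidStep (u ++ suc i ∷ i ∷ suc i ∷ v) (u ++ i ∷ suc i ∷ i ∷ v)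

data CommStep : List ℕ → List ℕ → Set where
  comm : ∀ u i j v → (suc i < j ⊎ suc j < i) → CommStep (u ++ i ∷ j ∷ v) (u ++ j ∷ i ∷ v)

BraidEquiv : List ℕ → List ℕ → Set
BraidEquiv = Star BraidStep

CommEquiv : List ℕ → List ℕ → Set
CommEquiv = Star CommStep

NumClasses : {A : Set} → (A → Set) → (A → A → Set) → ℕ → Set
NumClasses {A} P _~_ k =
  Σ[ L ∈ List A ] (length L ≡ k × All P L × AllPairs (λ x y → ¬ (x ~ y)) L
                   × (∀ x → P x → Any (x ~_) L))

Card : {A : Set} → (A → Set) → ℕ → Set
Card P k = NumClasses P _≡_ k

-- Label the p-th letter of a word i₁⋯iₖ by the transposition
-- s_{i₁}⋯s_{i_{p-1}} s_{i_p} s_{i_{p-1}}⋯s_{i₁}. A braid move reverses three consecutive labels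
-- that pairwise share a point, while a commutation move swaps two adjacent labels A, B with
-- disjoint supports. So the number of times A occurs before B is invariant under braid moves
-- but drops by one under that commutation move; dually, the number of occurrences of a letter
-- is invariant under commutation moves but changes under every braid move. Hence if |B(w)| = 1
-- no commutation move applies to a reduced word of w, every commutation class is a singleton
-- and |C(w)| = |R(w)|; symmetrically |C(w)| = 1 forces |B(w)| = |R(w)|.
module Submission where

open import Defs
open import Data.Empty using (⊥; ⊥-elim)
open import Data.Fin using (toℕ)
open import Data.Fin.Permutation using (Permutation′)
open import Data.List using (List; []; _∷_; _++_; [_]; length; reverse)
open import Data.List.Properties using (length-++; unfold-reverse)
open import Data.List.Membership.Propositional using (_∈_)
open import Data.List.Membership.Propositional.Properties.WithK using (unique∧set⇒bag)
open import Data.List.Relation.Binary.BagAndSetEquality using (∼bag⇒↭)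
open import Data.List.Relation.Binary.Permutation.Propositional.Properties using (↭-length)
open import Data.List.Relation.Unary.All as All using (All; []; _∷_)
open import Data.List.Relation.Unary.All.Properties using (++⁺; ++⁻; ++⁻ʳ)
open import Data.List.Relation.Unary.AllPairs as AllPairs using (AllPairs; []; _∷_)
open import Data.List.Relation.Unary.Any as Any using (Any; here)
open import Data.List.Relation.Unary.Unique.Propositional using (Unique)
open import Data.Nat
open import Data.Nat.Properties
open import Data.Nat.Tactic.RingSolver using (solve-∀)
open import Data.Product using (_×_; _,_; proj₁; proj₂; Σ-syntax)
open import Data.Product.Properties using (≡-dec)
open import Data.Sum using (_⊎_; inj₁; inj₂)
open import Function using (_∘_; id)
open import Function.Bundles using (mk⇔)
open import Relation.Binary.Definitions using (DecidableEquality; Reflexive; Symmetric)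
open import Relation.Binary.PropositionalEquality
  using (_≡_; _≢_; refl; sym; trans; cong; cong₂; subst; module ≡-Reasoning)
open import Relation.Binary.Construct.Closure.ReflexiveTransitive
  using (Star; ε; _◅_; _◅◅_) renaming (reverse to Star-reverse)
open import Relation.Nullary using (¬_; yes; no; Dec; _⊎-dec_)

module Precedence {X : Set} (_≟ₓ_ : DecidableEquality X) where

  occurrences : X → List X → ℕ
  occurrences a [] = 0
  occurrences a (x ∷ xs) with x ≟ₓ a
  ... | yes _ = suc (occurrences a xs)
  ... | no _  = occurrences a xs

  precedences : X → X → List X → ℕ
  precedences a b [] = 0
  precedences a b (x ∷ xs) with x ≟ₓ a
  ... | yes _ = occurrences b xs + precedences a b xs
  ... | no _  = precedences a b xs

  occurrences-++ : ∀ a xs ys → occurrences a (xs ++ ys) ≡ occurrences a xs + occurrences a ys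
  occurrences-++ a []       ys = refl
  occurrences-++ a (x ∷ xs) ys with x ≟ₓ a
  ... | yes _ = cong suc (occurrences-++ a xs ys)
  ... | no _  = occurrences-++ a xs ys

  occurrences-reverse : ∀ a xs → occurrences a (reverse xs) ≡ occurrences a xs
  occurrences-reverse a []       = refl
  occurrences-reverse a (x ∷ xs) = begin
    occurrences a (reverse (x ∷ xs))                  ≡⟨ cong (occurrences a) (unfold-reverse x xs) ⟩
    occurrences a (reverse xs ++ [ x ])               ≡⟨ occurrences-++ a (reverse xs) [ x ] ⟩
    occurrences a (reverse xs) + occurrences a [ x ]  ≡⟨ cong (_+ occurrences a [ x ]) (occurrences-reverse a xs) ⟩
    occurrences a xs + occurrences a [ x ]            ≡⟨ +-comm (occurrences a xs) _ ⟩
    occurrences a [ x ] + occurrences a xs            ≡⟨ occurrences-++ a [ x ] xs ⟨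
    occurrences a (x ∷ xs)                            ∎
    where open ≡-Reasoning

  occurrences-reverse-factor : ∀ a zs xs ts →
    occurrences a (zs ++ xs ++ ts) ≡ occurrences a (zs ++ reverse xs ++ ts)
  occurrences-reverse-factor a zs xs ts = begin
    occurrences a (zs ++ xs ++ ts)                   ≡⟨ occurrences-++ a zs _ ⟩
    occurrences a zs + occurrences a (xs ++ ts)      ≡⟨ cong (occurrences a zs +_) reversed ⟩
    occurrences a zs + occurrences a (reverse xs ++ ts) ≡⟨ occurrences-++ a zs _ ⟨
    occurrences a (zs ++ reverse xs ++ ts)           ∎
    where
    open ≡-Reasoning
    reversed : occurrences a (xs ++ ts) ≡ occurrences a (reverse xs ++ ts)
    reversed = begin
      occurrences a (xs ++ ts)                       ≡⟨ occurrences-++ a xs ts ⟩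
      occurrences a xs + occurrences a ts            ≡⟨ cong (_+ occurrences a ts) (occurrences-reverse a xs) ⟨
      occurrences a (reverse xs) + occurrences a ts  ≡⟨ occurrences-++ a (reverse xs) ts ⟨
      occurrences a (reverse xs ++ ts)               ∎

  occurrences-here : ∀ a xs → occurrences a (a ∷ xs) ≡ suc (occurrences a xs)
  occurrences-here a xs with a ≟ₓ a
  ... | yes _   = refl
  ... | no a≢a = ⊥-elim (a≢a refl)

  occurrences-there : ∀ {a x} xs → x ≢ a → occurrences a (x ∷ xs) ≡ occurrences a xs
  occurrences-there {a} {x} xs x≢a with x ≟ₓ a
  ... | yes x≡a = ⊥-elim (x≢a x≡a)
  ... | no _    = refl

  precedences-here : ∀ a b xs → precedences a b (a ∷ xs) ≡ occurrences b xs + precedences a b xs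
  precedences-here a b xs with a ≟ₓ a
  ... | yes _   = refl
  ... | no a≢a = ⊥-elim (a≢a refl)

  precedences-there : ∀ {a b x} xs → x ≢ a → precedences a b (x ∷ xs) ≡ precedences a b xs
  precedences-there {a} {b} {x} xs x≢a with x ≟ₓ a
  ... | yes x≡a = ⊥-elim (x≢a x≡a)
  ... | no _    = refl

  occurrences-aba : ∀ {a b} → a ≢ b → ∀ zs ts →
    occurrences a (zs ++ a ∷ b ∷ a ∷ ts) ≡ suc (occurrences a (zs ++ b ∷ a ∷ b ∷ ts))
  occurrences-aba {a} {b} a≢b zs ts = begin
    occurrences a (zs ++ a ∷ b ∷ a ∷ ts)             ≡⟨ occurrences-++ a zs _ ⟩
    occurrences a zs + occurrences a (a ∷ b ∷ a ∷ ts) ≡⟨ cong (occurrences a zs +_) aba ⟩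
    occurrences a zs + suc (occurrences a (b ∷ a ∷ b ∷ ts)) ≡⟨ +-suc _ _ ⟩
    suc (occurrences a zs + occurrences a (b ∷ a ∷ b ∷ ts)) ≡⟨ cong suc (occurrences-++ a zs _) ⟨
    suc (occurrences a (zs ++ b ∷ a ∷ b ∷ ts))       ∎
    where
    open ≡-Reasoning
    b≢a : b ≢ a
    b≢a = a≢b ∘ sym
    aba : occurrences a (a ∷ b ∷ a ∷ ts) ≡ suc (occurrences a (b ∷ a ∷ b ∷ ts))
    aba = begin
      occurrences a (a ∷ b ∷ a ∷ ts)           ≡⟨ occurrences-here a _ ⟩
      suc (occurrences a (b ∷ a ∷ ts))         ≡⟨ cong suc (occurrences-there _ b≢a) ⟩
      suc (occurrences a (a ∷ ts))             ≡⟨ cong suc (occurrences-here a ts) ⟩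
      suc (suc (occurrences a ts))             ≡⟨ cong (suc ∘ suc) (occurrences-there ts b≢a) ⟨
      suc (suc (occurrences a (b ∷ ts)))       ≡⟨ cong suc (occurrences-here a (b ∷ ts)) ⟨
      suc (occurrences a (a ∷ b ∷ ts))         ≡⟨ cong suc (occurrences-there _ b≢a) ⟨
      suc (occurrences a (b ∷ a ∷ b ∷ ts))     ∎

  occurrences-All≢ : ∀ {b xs} → All (_≢ b) xs → occurrences b xs ≡ 0
  occurrences-All≢ [] = refl
  occurrences-All≢ {b} {x ∷ xs} (x≢b ∷ xs≢b) with x ≟ₓ b
  ... | yes x≡b = ⊥-elim (x≢b x≡b)
  ... | no _    = occurrences-All≢ xs≢b

  precedences-++ : ∀ a b xs ys → precedences a b (xs ++ ys)
    ≡ precedences a b xs + occurrences a xs * occurrences b ys + precedences a b ys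
  precedences-++ a b []       ys = refl
  precedences-++ a b (x ∷ xs) ys with x ≟ₓ a
  ... | no _  = precedences-++ a b xs ys
  ... | yes _ = begin
    occurrences b (xs ++ ys) + precedences a b (xs ++ ys)
      ≡⟨ cong₂ _+_ (occurrences-++ b xs ys) (precedences-++ a b xs ys) ⟩
    (occurrences b xs + occurrences b ys)
      + (precedences a b xs + occurrences a xs * occurrences b ys + precedences a b ys)
      ≡⟨ rearrange (occurrences b xs) (occurrences b ys) (precedences a b xs) (occurrences a xs) (precedences a b ys) ⟩
    occurrences b xs + precedences a b xs + suc (occurrences a xs) * occurrences b ys + precedences a b ys
      ∎
    where
    open ≡-Reasoning
    rearrange : ∀ p q n c t → (p + q) + (n + c * q + t) ≡ p + n + suc c * q + t
    rearrange = solve-∀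

  precedences-++-congˡ : ∀ {a b} zs {xs ys} → occurrences b xs ≡ occurrences b ys →
    precedences a b xs ≡ precedences a b ys → precedences a b (zs ++ xs) ≡ precedences a b (zs ++ ys)
  precedences-++-congˡ {a} {b} zs {xs} {ys} occ≡ prec≡ = begin
    precedences a b (zs ++ xs)                                            ≡⟨ precedences-++ a b zs xs ⟩
    precedences a b zs + occurrences a zs * occurrences b xs + precedences a b xs
      ≡⟨ cong₂ (λ m p → precedences a b zs + occurrences a zs * m + p) occ≡ prec≡ ⟩
    precedences a b zs + occurrences a zs * occurrences b ys + precedences a b ys ≡⟨ precedences-++ a b zs ys ⟨
    precedences a b (zs ++ ys)                                            ∎
    where open ≡-Reasoning

  precedences-++-congʳ : ∀ {a b} xs ys ts → occurrences a xs ≡ occurrences a ys →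
    precedences a b xs ≡ precedences a b ys → precedences a b (xs ++ ts) ≡ precedences a b (ys ++ ts)
  precedences-++-congʳ {a} {b} xs ys ts occ≡ prec≡ = begin
    precedences a b (xs ++ ts)                                            ≡⟨ precedences-++ a b xs ts ⟩
    precedences a b xs + occurrences a xs * occurrences b ts + precedences a b ts
      ≡⟨ cong₂ (λ p m → p + m * occurrences b ts + precedences a b ts) prec≡ occ≡ ⟩
    precedences a b ys + occurrences a ys * occurrences b ts + precedences a b ts ≡⟨ precedences-++ a b ys ts ⟨
    precedences a b (ys ++ ts)                                            ∎
    where open ≡-Reasoning

  precedences-reverse-factor : ∀ {a b} zs xs ts → precedences a b xs ≡ 0 → precedences a b (reverse xs) ≡ 0 →
    precedences a b (zs ++ xs ++ ts) ≡ precedences a b (zs ++ reverse xs ++ ts)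
  precedences-reverse-factor {a} {b} zs xs ts none noneʳ =
    precedences-++-congˡ zs (occurrences-reverse-factor b [] xs ts)
      (precedences-++-congʳ xs (reverse xs) ts (sym (occurrences-reverse a xs)) (trans none (sym noneʳ)))

  precedences-swap : ∀ {a b} → a ≢ b → ∀ zs ts →
    precedences a b (zs ++ a ∷ b ∷ ts) ≡ suc (precedences a b (zs ++ b ∷ a ∷ ts))
  precedences-swap {a} {b} a≢b zs ts = begin
    precedences a b (zs ++ a ∷ b ∷ ts)
      ≡⟨ precedences-++ a b zs _ ⟩
    precedences a b zs + occurrences a zs * occurrences b (a ∷ b ∷ ts) + precedences a b (a ∷ b ∷ ts)
      ≡⟨ cong₂ (λ m p → precedences a b zs + occurrences a zs * m + p)
               (occurrences-reverse-factor b [] (a ∷ b ∷ []) ts) swap-head ⟩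
    precedences a b zs + occurrences a zs * occurrences b (b ∷ a ∷ ts) + suc (precedences a b (b ∷ a ∷ ts))
      ≡⟨ +-suc _ _ ⟩
    suc (precedences a b zs + occurrences a zs * occurrences b (b ∷ a ∷ ts) + precedences a b (b ∷ a ∷ ts))
      ≡⟨ cong suc (precedences-++ a b zs _) ⟨
    suc (precedences a b (zs ++ b ∷ a ∷ ts))
      ∎
    where
    open ≡-Reasoning
    b≢a : b ≢ a
    b≢a = a≢b ∘ sym
    swap-head : precedences a b (a ∷ b ∷ ts) ≡ suc (precedences a b (b ∷ a ∷ ts))
    swap-head = begin
      precedences a b (a ∷ b ∷ ts)                   ≡⟨ precedences-here a b _ ⟩
      occurrences b (b ∷ ts) + precedences a b (b ∷ ts)
        ≡⟨ cong₂ _+_ (occurrences-here b ts) (precedences-there ts b≢a) ⟩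
      suc (occurrences b ts + precedences a b ts)    ≡⟨ cong suc (precedences-here a b ts) ⟨
      suc (precedences a b (a ∷ ts))                 ≡⟨ cong suc (precedences-there (a ∷ ts) b≢a) ⟨
      suc (precedences a b (b ∷ a ∷ ts))             ∎

  precedences-AllPairs : ∀ {a b xs} → AllPairs (λ x y → x ≡ a → y ≢ b) xs → precedences a b xs ≡ 0
  precedences-AllPairs [] = refl
  precedences-AllPairs {a} {b} {x ∷ xs} (x-before ∷ rest) with x ≟ₓ a
  ... | yes x≡a = cong₂ _+_ (occurrences-All≢ (All.map (λ f → f x≡a) x-before)) (precedences-AllPairs rest)
  ... | no _    = precedences-AllPairs rest

module Letter = Precedence _≟_
module Reflection = Precedence (≡-dec _≟_ _≟_)

-- A pair (a , b) stands for the transposition of a and b; s_i swaps the pair support i.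
support : ℕ → ℕ × ℕ
support i = i ∸ 1 , i

_∈ᵖ_ : ℕ → ℕ × ℕ → Set
x ∈ᵖ (a , b) = x ≡ a ⊎ x ≡ b

_∈ᵖ?_ : ∀ x P → Dec (x ∈ᵖ P)
x ∈ᵖ? (a , b) = (x ≟ a) ⊎-dec (x ≟ b)

Disjointᵖ : ℕ × ℕ → ℕ × ℕ → Set
Disjointᵖ P Q = ∀ {x} → x ∈ᵖ P → x ∈ᵖ Q → ⊥

Disjointᵖ-sym : ∀ {P Q} → Disjointᵖ P Q → Disjointᵖ Q P
Disjointᵖ-sym disj x∈Q x∈P = disj x∈P x∈Q

Disjointᵖ⇒≢ : ∀ {P Q} → Disjointᵖ P Q → P ≢ Q
Disjointᵖ⇒≢ disj refl = disj (inj₁ refl) (inj₁ refl)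

∈support⇒bounds : ∀ {i x} → x ∈ᵖ support i → i ∸ 1 ≤ x × x ≤ i
∈support⇒bounds {i} (inj₁ refl) = ≤-refl , m∸n≤m i 1
∈support⇒bounds {i} (inj₂ refl) = m∸n≤m i 1 , ≤-refl

<-disjoint : ∀ {i j} → suc i < j → Disjointᵖ (support i) (support j)
<-disjoint i+1<j x∈i x∈j =
  ≤⇒≯ (proj₂ (∈support⇒bounds x∈i)) (≤-trans (∸-monoˡ-≤ 1 i+1<j) (proj₁ (∈support⇒bounds x∈j)))

far⇒disjoint : ∀ {i j} → suc i < j ⊎ suc j < i → Disjointᵖ (support i) (support j)
far⇒disjoint (inj₁ i+1<j) = <-disjoint i+1<j
far⇒disjoint (inj₂ j+1<i) = Disjointᵖ-sym (<-disjoint j+1<i)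

sAct-lower : ∀ i → sAct i (i ∸ 1) ≡ i
sAct-lower i with i ∸ 1 ≟ i ∸ 1
... | yes _ = refl
... | no ≢refl = ⊥-elim (≢refl refl)

sAct-upper : ∀ i → sAct i i ≡ i ∸ 1
sAct-upper zero = refl
sAct-upper (suc m) with suc m ≟ m
... | yes m+1≡m = ⊥-elim (1+n≢n m+1≡m)
... | no _ with suc m ≟ suc m
...   | yes _     = refl
...   | no ≢refl = ⊥-elim (≢refl refl)

sAct-∉ : ∀ {i x} → ¬ x ∈ᵖ support i → sAct i x ≡ x
sAct-∉ {i} {x} x∉ with x ≟ i ∸ 1
... | yes x≡i-1 = ⊥-elim (x∉ (inj₁ x≡i-1))
... | no _ with x ≟ i
...   | yes x≡i = ⊥-elim (x∉ (inj₂ x≡i))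
...   | no _    = refl

sAct-∈ : ∀ {i x} → x ∈ᵖ support i → sAct i x ∈ᵖ support i
sAct-∈ {i} (inj₁ refl) = inj₂ (sAct-lower i)
sAct-∈ {i} (inj₂ refl) = inj₁ (sAct-upper i)

sAct-above : ∀ {i x} → i < x → sAct i x ≡ x
sAct-above i<x = sAct-∉ (λ x∈ → <⇒≱ i<x (proj₂ (∈support⇒bounds x∈)))

sAct-below : ∀ {i x} → x < i ∸ 1 → sAct i x ≡ x
sAct-below x<i-1 = sAct-∉ (λ x∈ → <⇒≱ x<i-1 (proj₁ (∈support⇒bounds x∈)))

sAct-involutive : ∀ i x → sAct i (sAct i x) ≡ x
sAct-involutive i x with x ∈ᵖ? support i
... | yes (inj₁ refl) = trans (cong (sAct i) (sAct-lower i)) (sAct-upper i)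
... | yes (inj₂ refl) = trans (cong (sAct i) (sAct-upper i)) (sAct-lower i)
... | no x∉          = trans (cong (sAct i) (sAct-∉ x∉)) (sAct-∉ x∉)

sAct-injective : ∀ i {x y} → sAct i x ≡ sAct i y → x ≡ y
sAct-injective i {x} {y} eq = begin
  x                    ≡⟨ sAct-involutive i x ⟨
  sAct i (sAct i x)    ≡⟨ cong (sAct i) eq ⟩
  sAct i (sAct i y)    ≡⟨ sAct-involutive i y ⟩
  y                    ∎
  where open ≡-Reasoning

sAct-commute : ∀ {i j} → Disjointᵖ (support i) (support j) →
  ∀ x → sAct i (sAct j x) ≡ sAct j (sAct i x)
sAct-commute {i} {j} disj x with x ∈ᵖ? support i | x ∈ᵖ? support j
... | yes x∈i | _ = begin
  sAct i (sAct j x)   ≡⟨ cong (sAct i) (sAct-∉ (disj x∈i)) ⟩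
  sAct i x            ≡⟨ sAct-∉ (disj (sAct-∈ x∈i)) ⟨
  sAct j (sAct i x)   ∎
  where open ≡-Reasoning
... | no x∉i | yes x∈j = begin
  sAct i (sAct j x)   ≡⟨ sAct-∉ (λ s∈i → disj s∈i (sAct-∈ x∈j)) ⟩
  sAct j x            ≡⟨ cong (sAct j) (sAct-∉ x∉i) ⟨
  sAct j (sAct i x)   ∎
  where open ≡-Reasoning
... | no x∉i | no x∉j = begin
  sAct i (sAct j x)   ≡⟨ cong (sAct i) (sAct-∉ x∉j) ⟩
  sAct i x            ≡⟨ sAct-∉ x∉i ⟩
  x                   ≡⟨ sAct-∉ x∉j ⟨
  sAct j x            ≡⟨ cong (sAct j) (sAct-∉ x∉i) ⟨
  sAct j (sAct i x)   ∎
  where open ≡-Reasoning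

module Braid (m : ℕ) where
  s₁ s₂ : ℕ → ℕ
  s₁ = sAct (suc m)
  s₂ = sAct (suc (suc m))

  s₁-m : s₁ m ≡ suc m
  s₁-m = sAct-lower (suc m)

  s₁-m+1 : s₁ (suc m) ≡ m
  s₁-m+1 = sAct-upper (suc m)

  s₁-m+2 : s₁ (suc (suc m)) ≡ suc (suc m)
  s₁-m+2 = sAct-above (n<1+n (suc m))

  s₂-m : s₂ m ≡ m
  s₂-m = sAct-below (n<1+n m)

  s₂-m+1 : s₂ (suc m) ≡ suc (suc m)
  s₂-m+1 = sAct-lower (suc (suc m))

  s₂-m+2 : s₂ (suc (suc m)) ≡ suc m
  s₂-m+2 = sAct-upper (suc (suc m))

sAct-braid : ∀ m x → sAct (suc m) (sAct (suc (suc m)) (sAct (suc m) x))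
                   ≡ sAct (suc (suc m)) (sAct (suc m) (sAct (suc (suc m)) x))
sAct-braid m x with x ∈ᵖ? support (suc m) | x ∈ᵖ? support (suc (suc m))
... | yes (inj₁ refl) | _ = begin
  s₁ (s₂ (s₁ m))   ≡⟨ cong (s₁ ∘ s₂) s₁-m ⟩
  s₁ (s₂ (suc m))  ≡⟨ cong s₁ s₂-m+1 ⟩
  s₁ (suc (suc m)) ≡⟨ s₁-m+2 ⟩
  suc (suc m)      ≡⟨ s₂-m+1 ⟨
  s₂ (suc m)       ≡⟨ cong s₂ s₁-m ⟨
  s₂ (s₁ m)        ≡⟨ cong (s₂ ∘ s₁) s₂-m ⟨
  s₂ (s₁ (s₂ m))   ∎
  where open Braid m; open ≡-Reasoning
... | yes (inj₂ refl) | _ = begin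
  s₁ (s₂ (s₁ (suc m)))  ≡⟨ cong (s₁ ∘ s₂) s₁-m+1 ⟩
  s₁ (s₂ m)             ≡⟨ cong s₁ s₂-m ⟩
  s₁ m                  ≡⟨ s₁-m ⟩
  suc m                 ≡⟨ s₂-m+2 ⟨
  s₂ (suc (suc m))      ≡⟨ cong s₂ s₁-m+2 ⟨
  s₂ (s₁ (suc (suc m))) ≡⟨ cong (s₂ ∘ s₁) s₂-m+1 ⟨
  s₂ (s₁ (s₂ (suc m)))  ∎
  where open Braid m; open ≡-Reasoning
... | no x∉₁ | yes (inj₁ refl) = ⊥-elim (x∉₁ (inj₂ refl))
... | no _ | yes (inj₂ refl) = begin
  s₁ (s₂ (s₁ (suc (suc m)))) ≡⟨ cong (s₁ ∘ s₂) s₁-m+2 ⟩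
  s₁ (s₂ (suc (suc m)))      ≡⟨ cong s₁ s₂-m+2 ⟩
  s₁ (suc m)                 ≡⟨ s₁-m+1 ⟩
  m                          ≡⟨ s₂-m ⟨
  s₂ m                       ≡⟨ cong s₂ s₁-m+1 ⟨
  s₂ (s₁ (suc m))            ≡⟨ cong (s₂ ∘ s₁) s₂-m+2 ⟨
  s₂ (s₁ (s₂ (suc (suc m)))) ∎
  where open Braid m; open ≡-Reasoning
... | no x∉₁ | no x∉₂ = begin
  s₁ (s₂ (s₁ x)) ≡⟨ cong (s₁ ∘ s₂) (sAct-∉ x∉₁) ⟩
  s₁ (s₂ x)      ≡⟨ cong s₁ (sAct-∉ x∉₂) ⟩
  s₁ x           ≡⟨ sAct-∉ x∉₁ ⟩
  x              ≡⟨ sAct-∉ x∉₂ ⟨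
  s₂ x           ≡⟨ cong s₂ (sAct-∉ x∉₁) ⟨
  s₂ (s₁ x)      ≡⟨ cong (s₂ ∘ s₁) (sAct-∉ x∉₂) ⟨
  s₂ (s₁ (s₂ x)) ∎
  where open Braid m; open ≡-Reasoning

evalWord-++ : ∀ u v j → evalWord (u ++ v) j ≡ evalWord u (evalWord v j)
evalWord-++ []      v j = refl
evalWord-++ (i ∷ u) v j = cong (sAct i) (evalWord-++ u v j)

evalWord-injective : ∀ u {x y} → evalWord u x ≡ evalWord u y → x ≡ y
evalWord-injective []      eq = eq
evalWord-injective (i ∷ u) eq = evalWord-injective u (sAct-injective i eq)

evalWord-factor : ∀ {p q} → (∀ j → evalWord p j ≡ evalWord q j) →
  ∀ u v j → evalWord (u ++ p ++ v) j ≡ evalWord (u ++ q ++ v) j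
evalWord-factor {p} {q} p≗q u v j = begin
  evalWord (u ++ p ++ v) j               ≡⟨ evalWord-++ u _ j ⟩
  evalWord u (evalWord (p ++ v) j)       ≡⟨ cong (evalWord u) (evalWord-++ p v j) ⟩
  evalWord u (evalWord p (evalWord v j)) ≡⟨ cong (evalWord u) (p≗q (evalWord v j)) ⟩
  evalWord u (evalWord q (evalWord v j)) ≡⟨ cong (evalWord u) (evalWord-++ q v j) ⟨
  evalWord u (evalWord (q ++ v) j)       ≡⟨ evalWord-++ u _ j ⟨
  evalWord (u ++ q ++ v) j               ∎
  where open ≡-Reasoning

-- reflections id w lists the labels of the letters of w; g is the product of the letters already read.
reflection : (ℕ → ℕ) → ℕ → ℕ × ℕ
reflection g i = g (i ∸ 1) , g i

reflections : (ℕ → ℕ) → List ℕ → List (ℕ × ℕ)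
reflections g []       = []
reflections g (i ∷ is) = reflection g i ∷ reflections (g ∘ sAct i) is

reflections-++ : ∀ g u v → reflections g (u ++ v) ≡ reflections g u ++ reflections (g ∘ evalWord u) v
reflections-++ g []      v = refl
reflections-++ g (i ∷ u) v = cong (reflection g i ∷_) (reflections-++ (g ∘ sAct i) u v)

reflections-cong : ∀ {g h} → (∀ j → g j ≡ h j) → ∀ w → reflections g w ≡ reflections h w
reflections-cong g≗h []       = refl
reflections-cong g≗h (i ∷ is) =
  cong₂ _∷_ (cong₂ _,_ (g≗h (i ∸ 1)) (g≗h i)) (reflections-cong (g≗h ∘ sAct i) is)

∈reflection⇒preimage : ∀ {g k x} → x ∈ᵖ reflection g k → Σ[ p ∈ ℕ ] p ∈ᵖ support k × x ≡ g p
∈reflection⇒preimage {k = k} (inj₁ eq) = k ∸ 1 , inj₁ refl , eq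
∈reflection⇒preimage {k = k} (inj₂ eq) = k , inj₂ refl , eq

reflection-disjoint : ∀ {g i j} → (∀ {x y} → g x ≡ g y → x ≡ y) →
  Disjointᵖ (support i) (support j) → Disjointᵖ (reflection g i) (reflection g j)
reflection-disjoint {j = j} g-inj disj x∈ y∈
  with ∈reflection⇒preimage x∈ | ∈reflection⇒preimage y∈
... | p , p∈i , x≡gp | q , q∈j , x≡gq =
  disj p∈i (subst (_∈ᵖ support j) (g-inj (trans (sym x≡gq) x≡gp)) q∈j)

reflections-far : ∀ {i j} → Disjointᵖ (support i) (support j) → ∀ g v →
  reflections g (i ∷ j ∷ v) ≡ reflection g i ∷ reflection g j ∷ reflections (g ∘ sAct i ∘ sAct j) v
reflections-far {i} {j} disj g v =
  cong (λ r → reflection g i ∷ r ∷ reflections (g ∘ sAct i ∘ sAct j) v)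
       (cong₂ _,_ (cong g (sAct-∉ (λ j-1∈i → disj j-1∈i (inj₁ refl))))
                  (cong g (sAct-∉ (λ j∈i → disj j∈i (inj₂ refl)))))

triangle : ℕ → ℕ → ℕ → List (ℕ × ℕ)
triangle a b c = (a , b) ∷ (a , c) ∷ (b , c) ∷ []

reflections-braid⁺ : ∀ g m v → reflections g (suc m ∷ suc (suc m) ∷ suc m ∷ v)
  ≡ triangle (g m) (g (suc m)) (g (suc (suc m))) ++ reflections (g ∘ sAct (suc m) ∘ sAct (suc (suc m)) ∘ sAct (suc m)) v
reflections-braid⁺ g m v =
  cong (reflection g (suc m) ∷_)
    (cong₂ _∷_ (cong-pair s₁-m+1 s₁-m+2)
    (cong₂ _∷_ (cong-pair (trans (cong s₁ s₂-m) s₁-m) (trans (cong s₁ s₂-m+1) s₁-m+2)) refl))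
  where
  open Braid m
  cong-pair : ∀ {x y x′ y′} → x ≡ x′ → y ≡ y′ → (g x , g y) ≡ (g x′ , g y′)
  cong-pair x≡x′ y≡y′ = cong₂ _,_ (cong g x≡x′) (cong g y≡y′)


reflections-braid⁻ : ∀ g m v → reflections g (suc (suc m) ∷ suc m ∷ suc (suc m) ∷ v)
  ≡ reverse (triangle (g m) (g (suc m)) (g (suc (suc m))))
    ++ reflections (g ∘ sAct (suc m) ∘ sAct (suc (suc m)) ∘ sAct (suc m)) v
reflections-braid⁻ g m v =
  cong (reflection g (suc (suc m)) ∷_)
    (cong₂ _∷_ (cong-pair s₂-m s₂-m+1)
    (cong₂ _∷_ (cong-pair (trans (cong s₂ s₁-m+1) s₂-m) (trans (cong s₂ s₁-m+2) s₂-m+2))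
    (reflections-cong (λ j → cong g (sym (sAct-braid m j))) v)))
  where
  open Braid m
  cong-pair : ∀ {x y x′ y′} → x ≡ x′ → y ≡ y′ → (g x , g y) ≡ (g x′ , g y′)
  cong-pair x≡x′ y≡y′ = cong₂ _,_ (cong g x≡x′) (cong g y≡y′)


open Reflection using (precedences; precedences-reverse-factor; precedences-swap; precedences-AllPairs)

module _ {A B : ℕ × ℕ} (disj : Disjointᵖ A B) where

  private
    apart : ∀ {e P Q} → e ∈ᵖ P → e ∈ᵖ Q → P ≡ A → Q ≢ B
    apart e∈P e∈Q refl refl = disj e∈P e∈Q

  precedences-triangle : ∀ a b c → precedences A B (triangle a b c) ≡ 0
  precedences-triangle a b c = precedences-AllPairs {xs = triangle a b c}
    ((apart (inj₁ refl) (inj₁ refl) ∷ apart (inj₂ refl) (inj₁ refl) ∷ [])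
    ∷ (apart (inj₂ refl) (inj₂ refl) ∷ []) ∷ [] ∷ [])

  precedences-reverse-triangle : ∀ a b c → precedences A B (reverse (triangle a b c)) ≡ 0
  precedences-reverse-triangle a b c = precedences-AllPairs {xs = reverse (triangle a b c)}
    ((apart (inj₂ refl) (inj₂ refl) ∷ apart (inj₁ refl) (inj₂ refl) ∷ [])
    ∷ (apart (inj₁ refl) (inj₁ refl) ∷ []) ∷ [] ∷ [])

  precedences-braid : ∀ g u m v →
    precedences A B (reflections g (u ++ suc m ∷ suc (suc m) ∷ suc m ∷ v))
      ≡ precedences A B (reflections g (u ++ suc (suc m) ∷ suc m ∷ suc (suc m) ∷ v))
  precedences-braid g u m v = begin
    precedences A B (reflections g (u ++ suc m ∷ suc (suc m) ∷ suc m ∷ v))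
      ≡⟨ cong (precedences A B) (reflections-++ g u _) ⟩
    precedences A B (reflections g u ++ reflections g′ (suc m ∷ suc (suc m) ∷ suc m ∷ v))
      ≡⟨ cong (λ r → precedences A B (reflections g u ++ r)) (reflections-braid⁺ g′ m v) ⟩
    precedences A B (reflections g u ++ triangle a b c ++ tail)
      ≡⟨ precedences-reverse-factor (reflections g u) (triangle a b c) tail
           (precedences-triangle a b c) (precedences-reverse-triangle a b c) ⟩
    precedences A B (reflections g u ++ reverse (triangle a b c) ++ tail)
      ≡⟨ cong (λ r → precedences A B (reflections g u ++ r)) (reflections-braid⁻ g′ m v) ⟨
    precedences A B (reflections g u ++ reflections g′ (suc (suc m) ∷ suc m ∷ suc (suc m) ∷ v))
      ≡⟨ cong (precedences A B) (reflections-++ g u _) ⟨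
    precedences A B (reflections g (u ++ suc (suc m) ∷ suc m ∷ suc (suc m) ∷ v))
      ∎
    where
    open ≡-Reasoning
    g′ = g ∘ evalWord u
    a = g′ m
    b = g′ (suc m)
    c = g′ (suc (suc m))
    tail = reflections (g′ ∘ sAct (suc m) ∘ sAct (suc (suc m)) ∘ sAct (suc m)) v

All-factor : ∀ {P : ℕ → Set} u {p q} v → (All P p → All P q) → All P (u ++ p ++ v) → All P (u ++ q ++ v)
All-factor u {p} v p⇒q all-upv with ++⁻ u all-upv
... | all-u , all-pv with ++⁻ p all-pv
...   | all-p , all-v = ++⁺ all-u (++⁺ (p⇒q all-p) all-v)

All-braidStep : ∀ {P : ℕ → Set} {x y} → BraidStep x y → All P x → All P y
All-braidStep (braid⁺ u i v) = All-factor u v λ { (a ∷ b ∷ _ ∷ []) → b ∷ a ∷ b ∷ [] }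
All-braidStep (braid⁻ u i v) = All-factor u v λ { (a ∷ b ∷ _ ∷ []) → b ∷ a ∷ b ∷ [] }

All-commStep : ∀ {P : ℕ → Set} {x y} → CommStep x y → All P x → All P y
All-commStep (comm u i j v _) = All-factor u v λ { (a ∷ b ∷ []) → b ∷ a ∷ [] }

precedences-braidStep : ∀ {A B} → Disjointᵖ A B → ∀ g {x y} → All (1 ≤_) x → BraidStep x y →
  precedences A B (reflections g x) ≡ precedences A B (reflections g y)
precedences-braidStep disj g valid (braid⁺ u i v) with ++⁻ʳ u valid
... | s≤s z≤n ∷ _ = precedences-braid disj g u _ v
precedences-braidStep disj g valid (braid⁻ u i v) with ++⁻ʳ u valid
... | _ ∷ s≤s z≤n ∷ _ = sym (precedences-braid disj g u _ v)

precedences-braidEquiv : ∀ {A B} → Disjointᵖ A B → ∀ g {x y} → All (1 ≤_) x → BraidEquiv x y →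
  precedences A B (reflections g x) ≡ precedences A B (reflections g y)
precedences-braidEquiv disj g valid ε              = refl
precedences-braidEquiv disj g valid (step ◅ steps) =
  trans (precedences-braidStep disj g valid step)
        (precedences-braidEquiv disj g (All-braidStep step valid) steps)

precedences-commStep : ∀ {x y} → CommStep x y →
  Σ[ A ∈ ℕ × ℕ ] Σ[ B ∈ ℕ × ℕ ] Disjointᵖ A B
    × precedences A B (reflections id x) ≡ suc (precedences A B (reflections id y))
precedences-commStep (comm u i j v far) = A , B , disjAB , (begin
  precedences A B (reflections id (u ++ i ∷ j ∷ v))
    ≡⟨ cong (precedences A B) (reflections-++ id u _) ⟩
  precedences A B (R ++ reflections g (i ∷ j ∷ v))
    ≡⟨ cong (λ r → precedences A B (R ++ r)) (reflections-far disj g v) ⟩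
  precedences A B (R ++ A ∷ B ∷ reflections (g ∘ sAct i ∘ sAct j) v)
    ≡⟨ precedences-swap (Disjointᵖ⇒≢ disjAB) R _ ⟩
  suc (precedences A B (R ++ B ∷ A ∷ reflections (g ∘ sAct i ∘ sAct j) v))
    ≡⟨ cong (λ r → suc (precedences A B (R ++ B ∷ A ∷ r)))
            (reflections-cong (cong g ∘ sAct-commute disj) v) ⟩
  suc (precedences A B (R ++ B ∷ A ∷ reflections (g ∘ sAct j ∘ sAct i) v))
    ≡⟨ cong (λ r → suc (precedences A B (R ++ r))) (reflections-far (Disjointᵖ-sym disj) g v) ⟨
  suc (precedences A B (R ++ reflections g (j ∷ i ∷ v)))
    ≡⟨ cong (suc ∘ precedences A B) (reflections-++ id u _) ⟨
  suc (precedences A B (reflections id (u ++ j ∷ i ∷ v)))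
    ∎)
  where
  open ≡-Reasoning
  g = evalWord u
  R = reflections id u
  disj = far⇒disjoint far
  A = reflection g i
  B = reflection g j
  disjAB = reflection-disjoint (evalWord-injective u) disj

letterCount-braidStep : ∀ {x y} → BraidStep x y → Σ[ i ∈ ℕ ] Letter.occurrences i x ≢ Letter.occurrences i y
letterCount-braidStep (braid⁺ u i v) = i , λ eq →
  1+n≢n (sym (trans (sym eq) (Letter.occurrences-aba (λ e → 1+n≢n (sym e)) u v)))
letterCount-braidStep (braid⁻ u i v) = i , λ eq →
  1+n≢n (sym (trans eq (Letter.occurrences-aba (λ e → 1+n≢n (sym e)) u v)))

letterCount-commEquiv : ∀ {x y} → CommEquiv x y → ∀ k → Letter.occurrences k x ≡ Letter.occurrences k y
letterCount-commEquiv ε                        k = refl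
letterCount-commEquiv (comm u i j v _ ◅ steps) k =
  trans (Letter.occurrences-reverse-factor k u (i ∷ j ∷ []) v) (letterCount-commEquiv steps k)

-- Positivity of the letter matters: sAct 0 is the identity, so 010 and 101 differ.
evalWord-braidStep : ∀ {x y} → All (1 ≤_) x → BraidStep x y → ∀ j → evalWord x j ≡ evalWord y j
evalWord-braidStep valid (braid⁺ u i v) with ++⁻ʳ u valid
... | s≤s z≤n ∷ _ = evalWord-factor (sAct-braid _) u v
evalWord-braidStep valid (braid⁻ u i v) with ++⁻ʳ u valid
... | _ ∷ s≤s z≤n ∷ _ = evalWord-factor (sym ∘ sAct-braid _) u v

evalWord-commStep : ∀ {x y} → CommStep x y → ∀ j → evalWord x j ≡ evalWord y j
evalWord-commStep (comm u i j v far) =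
  evalWord-factor {p = i ∷ j ∷ []} {q = j ∷ i ∷ []} (sAct-commute (far⇒disjoint far)) u v

length-braidStep : ∀ {x y} → BraidStep x y → length y ≡ length x
length-braidStep (braid⁺ u _ _) = trans (length-++ u) (sym (length-++ u))
length-braidStep (braid⁻ u _ _) = trans (length-++ u) (sym (length-++ u))

length-commStep : ∀ {x y} → CommStep x y → length y ≡ length x
length-commStep (comm u _ _ _ _) = trans (length-++ u) (sym (length-++ u))

module _ {n : ℕ} {w : Permutation′ n} where

  reduced-sameLength : ∀ {x y} → IsReduced n w x → IsWord n w y → length y ≡ length x → IsReduced n w y
  reduced-sameLength (_ , minimal) y-word len =
    y-word , λ vs vs-word → subst (_≤ length vs) (sym len) (minimal vs vs-word)

  reduced-braidStep : ∀ {x y} → IsReduced n w x → BraidStep x y → IsReduced n w y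
  reduced-braidStep x-red@((valid , eval) , _) step = reduced-sameLength x-red
    (All-braidStep step valid , λ j → trans (eval j) (evalWord-braidStep (All.map proj₁ valid) step (toℕ j)))
    (length-braidStep step)

  reduced-commStep : ∀ {x y} → IsReduced n w x → CommStep x y → IsReduced n w y
  reduced-commStep x-red@((valid , eval) , _) step = reduced-sameLength x-red
    (All-commStep step valid , λ j → trans (eval j) (evalWord-commStep step (toℕ j)))
    (length-commStep step)

braidStep-sym : Symmetric BraidStep
braidStep-sym (braid⁺ u i v) = braid⁻ u i v
braidStep-sym (braid⁻ u i v) = braid⁺ u i v

commStep-sym : Symmetric CommStep
commStep-sym (comm u i j v (inj₁ i+1<j)) = comm u j i v (inj₂ i+1<j)
commStep-sym (comm u i j v (inj₂ j+1<i)) = comm u j i v (inj₁ j+1<i)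

module _ {A : Set} {P : A → Set} where

  classes≡card : ∀ {R : A → A → Set} {k r} → Reflexive R → (∀ {x y} → P x → R x y → x ≡ y) →
    NumClasses P R k → Card P r → k ≡ r
  classes≡card {R} R-refl R⇒≡ (L , refl , P-L , L-inequiv , L-covers) (M , refl , P-M , M-distinct , M-covers) =
    ↭-length (∼bag⇒↭ (unique∧set⇒bag L-distinct M-distinct (mk⇔ L⊆M M⊆L)))
    where
    L-distinct : Unique L
    L-distinct = AllPairs.map (λ ¬xRy x≡y → ¬xRy (subst (R _) x≡y R-refl)) L-inequiv
    L⊆M : ∀ {x} → x ∈ L → x ∈ M
    L⊆M x∈L = M-covers _ (All.lookup P-L x∈L)
    M⊆L : ∀ {x} → x ∈ M → x ∈ L
    M⊆L x∈M = Any.map (R⇒≡ P-x) (L-covers _ P-x)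
      where P-x = All.lookup P-M x∈M

  oneClass⇒related : ∀ {S : A → A → Set} → Symmetric S → NumClasses P (Star S) 1 →
    ∀ {x y} → P x → P y → Star S x y
  oneClass⇒related {S} S-sym (l ∷ [] , _ , _ , _ , covers) P-x P-y =
    toRepresentative (covers _ P-x) ◅◅ Star-reverse S-sym (toRepresentative (covers _ P-y))
    where
    toRepresentative : ∀ {x} → Any (Star S x) (l ∷ []) → Star S x l
    toRepresentative (here x~l) = x~l

noStep⇒≡ : ∀ {A : Set} {S : A → A → Set} {x y} → (∀ {z} → ¬ S x z) → Star S x y → x ≡ y
noStep⇒≡ no-step ε          = refl
noStep⇒≡ no-step (step ◅ _) = ⊥-elim (no-step step)

module _ {n : ℕ} {w : Permutation′ n} where

  oneBraidClass⇒noCommStep : NumClasses (IsReduced n w) BraidEquiv 1 →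
    ∀ {x} → IsReduced n w x → ∀ {y} → ¬ CommStep x y
  oneBraidClass⇒noCommStep one x-red step with precedences-commStep step
  ... | A , B , disj , drops = 1+n≢n (sym (trans (sym invariant) drops))
    where
    invariant = precedences-braidEquiv disj id (All.map proj₁ (proj₁ (proj₁ x-red)))
      (oneClass⇒related {P = IsReduced n w} braidStep-sym one x-red (reduced-commStep {w = w} x-red step))

  oneCommClass⇒noBraidStep : NumClasses (IsReduced n w) CommEquiv 1 →
    ∀ {x} → IsReduced n w x → ∀ {y} → ¬ BraidStep x y
  oneCommClass⇒noBraidStep one x-red step with letterCount-braidStep step
  ... | i , changes = changes (letterCount-commEquiv
          (oneClass⇒related {P = IsReduced n w} commStep-sym one x-red (reduced-braidStep {w = w} x-red step)) i)

  oneBraidClass⇒commEquiv⇒≡ : NumClasses (IsReduced n w) BraidEquiv 1 →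
    ∀ {x y} → IsReduced n w x → CommEquiv x y → x ≡ y
  oneBraidClass⇒commEquiv⇒≡ one x-red = noStep⇒≡ (oneBraidClass⇒noCommStep one x-red)

  oneCommClass⇒braidEquiv⇒≡ : NumClasses (IsReduced n w) CommEquiv 1 →
    ∀ {x y} → IsReduced n w x → BraidEquiv x y → x ≡ y
  oneCommClass⇒braidEquiv⇒≡ one x-red = noStep⇒≡ (oneCommClass⇒noBraidStep one x-red)

corollary4p9 : (n : ℕ) (w : Permutation′ n) (b c r : ℕ)
    → NumClasses (IsReduced n w) BraidEquiv b
    → NumClasses (IsReduced n w) CommEquiv c
    → Card (IsReduced n w) r
    → (b ≡ 1 ⊎ c ≡ 1)
    → (b + c ∸ 1 ≡ r) × (r ≡ b * c)
corollary4p9 n w b c r braidClasses commClasses card (inj₁ refl)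
  with classes≡card {R = CommEquiv} ε (oneBraidClass⇒commEquiv⇒≡ {w = w} braidClasses) commClasses card
... | refl = refl , sym (*-identityˡ c)
corollary4p9 n w b c r braidClasses commClasses card (inj₂ refl)
  with classes≡card {R = BraidEquiv} ε (oneCommClass⇒braidEquiv⇒≡ {w = w} commClasses) braidClasses card
... | refl = m+n∸n≡m b 1 , sym (*-identityʳ b)
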